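{- Let $T:\{0,1\}^*\to\{0,1\}^*$ be an aperiodic morphism such that $T(1)$ is a prefix of $T(01)$. Then $T$ is either order-preserving on infinite words or order-reversing on infinite words.
   Context: A binary morphism $T$ is aperiodic if $T(0)$ and $T(1)$ are not powers of a common word. Infinite binary words are ordered lexicographically with $0<1$ ($u<v$ if $u=xay$, $v=xbz$ with letters $a<b$). $T$ is order-preserving on infinite words if for all infinite words $u\le v$ we have $T(u)\le T(v)$; it is order-reversing on infinite words if for all infinite words $u<v$ we have $T(u)>T(v)$. -}

module Defs where

open import Data.Bool using (Bool; true; false)
open import Data.Nat using (ℕ; zero; suc; _<_)
open import Data.List using (List; []; _∷_; _++_; concat; concatMap; replicate; length; take)
open import Data.List.Relation.Binary.Prefix.Heterogeneous using (Prefix)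
open import Data.Fin using (Fin; toℕ)
open import Data.List using (lookup)
open import Data.Product using (Σ; ∃; ∃-syntax; _×_)
open import Data.Sum using (_⊎_)
open import Relation.Nullary using (¬_)
open import Relation.Binary.PropositionalEquality using (_≡_)

-- Binary alphabet {0,1} is Bool with false = 0, true = 1.
Word : Set
Word = List Bool

InfWord : Set
InfWord = ℕ → Bool

Morphism : Set
Morphism = Bool → Word

apply : Morphism → Word → Word
apply T = concatMap T

_^ʷ_ : Word → ℕ → Word
w ^ʷ n = concat (replicate n w)

Aperiodic : Morphism → Set
Aperiodic T = ¬ (∃[ w ] ∃[ m ] ∃[ n ] (T false ≡ w ^ʷ m × T true ≡ w ^ʷ n))

IsPrefix : Word → Word → Set
IsPrefix = Prefix _≡_

pref : ℕ → InfWord → Word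
pref zero    u = []
pref (suc n) u = u 0 ∷ pref n (λ i → u (suc i))

IsPrefixInf : Word → InfWord → Set
IsPrefixInf x w = pref (length x) w ≡ x

-- w is the image T(u) of the infinite word u: every T(u[0..n)) is a prefix of w.
-- (For an aperiodic T both images are nonempty, so T(u) is infinite and this
-- relation determines w uniquely.)
Image : Morphism → InfWord → InfWord → Set
Image T u w = ∀ n → IsPrefixInf (apply T (pref n u)) w

_<ˡ_ : InfWord → InfWord → Set
u <ˡ v = ∃[ n ] ((∀ i → i < n → u i ≡ v i) × u n ≡ false × v n ≡ true)

_≡ˡ_ : InfWord → InfWord → Set
u ≡ˡ v = ∀ i → u i ≡ v i

_≤ˡ_ : InfWord → InfWord → Set
u ≤ˡ v = u <ˡ v ⊎ u ≡ˡ v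

OrderPreserving : Morphism → Set
OrderPreserving T = ∀ u v x y → u ≤ˡ v → Image T u x → Image T v y → x ≤ˡ y

OrderReversing : Morphism → Set
OrderReversing T = ∀ u v x y → u <ˡ v → Image T u x → Image T v y → y <ˡ x

-- Let x = T(0) and y = T(1). If xy ≠ yx, then the words of x{x,y}^ω and of
-- y{x,y}^ω all pass through a common stem z and then branch with two distinct
-- letters a ≠ b. This is proved by induction on |x| + |y|: if x is a proper
-- prefix of y = xy′, the branching of the pair (x, y′) with stem z yields that
-- of (x, y) with stem xz. Consequently, if u < v first differ at position m,
-- then T(u) and T(v) first differ right after T(u[0..m)) z, with letters a and
-- b, so T preserves the order when a < b and reverses it when a > b.
module Submission where

open import Data.Bool using (Bool; true; false; not; _≟_)
open import Data.Empty using (⊥-elim)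
open import Data.List using ([]; _∷_; _++_; length)
open import Data.List.Properties
  using (++-assoc; ++-identityʳ; length-++; length-++-≤ˡ; length-++-≤ʳ; concatMap-++;
         ∷-injective; ∷-injectiveˡ; ∷-injectiveʳ)
open import Data.Nat using (ℕ; zero; suc; _+_; _≤_; _<_; z≤n; s≤s)
open import Data.Nat.Induction using (<-wellFounded)
open import Data.Nat.Properties using (≤-trans; n≮0; +-comm; +-mono-≤; +-monoʳ-<)
open import Data.Product using (∃-syntax; _×_; _,_)
open import Data.Sum using (_⊎_; inj₁; inj₂)
import Data.Sum as Sum
open import Function using (_∘_)
open import Induction.WellFounded using (Acc; acc)
open import Relation.Nullary using (yes; no)
open import Relation.Binary.PropositionalEquality
  using (_≡_; _≢_; refl; sym; trans; cong; cong₂; subst; module ≡-Reasoning)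

open import Defs

private
  variable
    x y w : Word
    a b : Bool
    u v X Y : InfWord

++-prepend : ∀ x {p z q : Word} → p ≡ z ++ q → x ++ p ≡ (x ++ z) ++ q
++-prepend x {z = z} {q} p≡zq = trans (cong (x ++_) p≡zq) (sym (++-assoc x z q))

length-++-cancelˡ-≤ : ∀ x {y w : Word} → length (x ++ y) ≤ length (x ++ w) → length y ≤ length w
length-++-cancelˡ-≤ []      le       = le
length-++-cancelˡ-≤ (_ ∷ x) (s≤s le) = length-++-cancelˡ-≤ x le

CommonPower : Word → Word → Set
CommonPower x y = ∃[ w ] ∃[ m ] ∃[ n ] (x ≡ w ^ʷ m × y ≡ w ^ʷ n)

^ʷ-+ : ∀ w m n → w ^ʷ (m + n) ≡ w ^ʷ m ++ w ^ʷ n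
^ʷ-+ w zero    n = refl
^ʷ-+ w (suc m) n = ++-prepend w (^ʷ-+ w m n)

CommonPower-[]ˡ : ∀ y → CommonPower [] y
CommonPower-[]ˡ y = y , 0 , 1 , refl , sym (++-identityʳ y)

CommonPower-sym : CommonPower x y → CommonPower y x
CommonPower-sym (w , m , n , x≡wᵐ , y≡wⁿ) = w , n , m , y≡wⁿ , x≡wᵐ

CommonPower-++ : CommonPower x y → CommonPower x (x ++ y)
CommonPower-++ (w , m , n , refl , refl) = w , m , m + n , refl , sym (^ʷ-+ w m n)

data Compare : Word → Word → Set where
  prefixˡ : ∀ x y′ → Compare x (x ++ y′)
  prefixʳ : ∀ x′ y → Compare (y ++ x′) y
  diverge : ∀ z r s → a ≢ b → Compare (z ++ a ∷ r) (z ++ b ∷ s)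

compare : ∀ x y → Compare x y
compare []      y       = prefixˡ [] y
compare (a ∷ x) []      = prefixʳ (a ∷ x) []
compare (a ∷ x) (b ∷ y) with a ≟ b
... | no a≢b = diverge [] x y a≢b
... | yes refl with compare x y
...   | prefixˡ x y′        = prefixˡ (a ∷ x) y′
...   | prefixʳ x′ y        = prefixʳ x′ (a ∷ y)
...   | diverge z r s a≢b   = diverge (a ∷ z) r s a≢b

infix 4 _∈⟨_,_⟩*

data _∈⟨_,_⟩* : Word → Word → Word → Set where
  ε   : [] ∈⟨ x , y ⟩*
  x∷_ : w ∈⟨ x , y ⟩* → x ++ w ∈⟨ x , y ⟩*
  y∷_ : w ∈⟨ x , y ⟩* → y ++ w ∈⟨ x , y ⟩*

∈*-swap : w ∈⟨ x , y ⟩* → w ∈⟨ y , x ⟩*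
∈*-swap ε      = ε
∈*-swap (x∷ p) = y∷ ∈*-swap p
∈*-swap (y∷ p) = x∷ ∈*-swap p

∈⟨x,xy⟩*⇒∈⟨x,y⟩* : w ∈⟨ x , x ++ y ⟩* → w ∈⟨ x , y ⟩*
∈⟨x,xy⟩*⇒∈⟨x,y⟩* ε      = ε
∈⟨x,xy⟩*⇒∈⟨x,y⟩* (x∷ p) = x∷ ∈⟨x,xy⟩*⇒∈⟨x,y⟩* p
∈⟨x,xy⟩*⇒∈⟨x,y⟩* {x = x} {y} (y∷_ {w} p) =
  subst (_∈⟨ x , y ⟩*) (sym (++-assoc x y w)) (x∷ y∷ ∈⟨x,xy⟩*⇒∈⟨x,y⟩* p)

Branch : Word → Word → Word → Bool → Set
Branch x y z a = ∀ {w} → w ∈⟨ x , y ⟩* → length y ≤ length w → ∃[ r ] x ++ w ≡ z ++ a ∷ r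

record Separation (x y : Word) : Set where
  constructor separation
  field
    stem     : Word
    x-letter : Bool
    y-letter : Bool
    letters≢ : x-letter ≢ y-letter
    x-branch : Branch x y stem x-letter
    y-branch : Branch y x stem y-letter

Separation-sym : Separation x y → Separation y x
Separation-sym (separation z a b a≢b x-branch y-branch) =
  separation z b a (a≢b ∘ sym) y-branch x-branch

separation-diverge : ∀ z r s → a ≢ b → Separation (z ++ a ∷ r) (z ++ b ∷ s)
separation-diverge {a} {b} z r s a≢b =
  separation z a b a≢b (λ {w} _ _ → r ++ w , ++-assoc z (a ∷ r) w)
                       (λ {w} _ _ → s ++ w , ++-assoc z (b ∷ s) w)

≢[]⇒0<length : x ≢ [] → 0 < length x
≢[]⇒0<length {[]}    x≢[] = ⊥-elim (x≢[] refl)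
≢[]⇒0<length {_ ∷ _} _    = s≤s z≤n

separation-++ : x ≢ [] → Separation x y → Separation x (x ++ y)
separation-++ {x} {y} x≢[] (separation z a b a≢b x-branch y-branch) =
  separation (x ++ z) a b a≢b x-branch′ y-branch′
  where
  x-branch′ : Branch x (x ++ y) (x ++ z) a
  x-branch′ ε le = ⊥-elim (n≮0 (≤-trans (≢[]⇒0<length x≢[]) (≤-trans (length-++-≤ˡ x) le)))
  x-branch′ (x∷ p) le =
    let r , e = x-branch (∈⟨x,xy⟩*⇒∈⟨x,y⟩* p) (length-++-cancelˡ-≤ x le)
    in r , ++-prepend x e
  x-branch′ (y∷_ {w} p) _ =
    let r , e = x-branch (y∷ ∈⟨x,xy⟩*⇒∈⟨x,y⟩* p) (length-++-≤ˡ y)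
    in r , trans (cong (x ++_) (++-assoc x y w)) (++-prepend x e)

  y-branch′ : Branch (x ++ y) x (x ++ z) b
  y-branch′ {w} p le =
    let r , e = y-branch (∈*-swap (∈⟨x,xy⟩*⇒∈⟨x,y⟩* (∈*-swap p))) le
    in r , trans (++-assoc x y w) (++-prepend x e)

commonPower⊎separation : ∀ x y → CommonPower x y ⊎ Separation x y
commonPower⊎separation x y = go x y (<-wellFounded _)
  where
  shorterˡ : ∀ c x′ y′ → length (c ∷ x′) + length y′ < length (c ∷ x′) + length (c ∷ x′ ++ y′)
  shorterˡ c x′ y′ = +-monoʳ-< (length (c ∷ x′)) (s≤s (length-++-≤ʳ y′ {x′}))

  shorterʳ : ∀ c y′ x′ → length (c ∷ y′) + length x′ < length (c ∷ y′ ++ x′) + length (c ∷ y′)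
  shorterʳ c y′ x′ =
    subst (length (c ∷ y′) + length x′ <_) (+-comm (length (c ∷ y′)) (length (c ∷ y′ ++ x′)))
          (shorterˡ c y′ x′)

  go : ∀ x y → Acc _<_ (length x + length y) → CommonPower x y ⊎ Separation x y
  go x y (acc rec) with compare x y
  ... | diverge z r s a≢b    = inj₂ (separation-diverge z r s a≢b)
  ... | prefixˡ [] y′        = inj₁ (CommonPower-[]ˡ y′)
  ... | prefixˡ (c ∷ x′) y′  =
    Sum.map CommonPower-++ (separation-++ λ ()) (go (c ∷ x′) y′ (rec (shorterˡ c x′ y′)))
  ... | prefixʳ x′ []        = inj₁ (CommonPower-sym (CommonPower-[]ˡ x′))
  ... | prefixʳ x′ (c ∷ y′)  =
    Sum.map (CommonPower-sym ∘ CommonPower-++) (Separation-sym ∘ separation-++ λ ())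
            (go (c ∷ y′) x′ (rec (shorterʳ c y′ x′)))

FirstDifference : InfWord → InfWord → Bool → Bool → Set
FirstDifference u v a b = ∃[ n ] ((∀ i → i < n → u i ≡ v i) × u n ≡ a × v n ≡ b)

FirstDifference-sym : FirstDifference u v a b → FirstDifference v u b a
FirstDifference-sym (n , agree , uₙ≡a , vₙ≡b) = n , (λ i i<n → sym (agree i i<n)) , vₙ≡b , uₙ≡a

length-pref : ∀ n u → length (pref n u) ≡ n
length-pref zero    u = refl
length-pref (suc n) u = cong suc (length-pref n (u ∘ suc))

pref-split : ∀ m k u → pref (m + suc k) u ≡ pref m u ++ u m ∷ pref k (λ i → u (suc m + i))
pref-split zero    k u = refl
pref-split (suc m) k u = cong (u 0 ∷_) (pref-split m k (u ∘ suc))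

pref-cong : ∀ m → (∀ i → i < m → u i ≡ v i) → pref m u ≡ pref m v
pref-cong zero    u≡v = refl
pref-cong (suc m) u≡v = cong₂ _∷_ (u≡v 0 (s≤s z≤n)) (pref-cong m (λ i i<m → u≡v (suc i) (s≤s i<m)))

IsPrefixInf-++ˡ : ∀ p q → IsPrefixInf (p ++ q) u → IsPrefixInf p u
IsPrefixInf-++ˡ []      q pre = refl
IsPrefixInf-++ˡ (c ∷ p) q pre with ∷-injective pre
... | refl , pre′ = cong (c ∷_) (IsPrefixInf-++ˡ p q pre′)

IsPrefixInf-at : ∀ p q → IsPrefixInf (p ++ a ∷ q) u → u (length p) ≡ a
IsPrefixInf-at []      q pre = ∷-injectiveˡ pre
IsPrefixInf-at (_ ∷ p) q pre = IsPrefixInf-at p q (∷-injectiveʳ pre)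

IsPrefixInf-agree : ∀ p → IsPrefixInf p u → IsPrefixInf p v → ∀ i → i < length p → u i ≡ v i
IsPrefixInf-agree (_ ∷ p) pu pv zero    _         = trans (∷-injectiveˡ pu) (sym (∷-injectiveˡ pv))
IsPrefixInf-agree (_ ∷ p) pu pv (suc i) (s≤s i<p) =
  IsPrefixInf-agree p (∷-injectiveʳ pu) (∷-injectiveʳ pv) i i<p

firstDifference-prefixes : ∀ p {q r} → IsPrefixInf (p ++ a ∷ q) u → IsPrefixInf (p ++ b ∷ r) v →
                           FirstDifference u v a b
firstDifference-prefixes p {q} {r} pu pv =
  length p , IsPrefixInf-agree p (IsPrefixInf-++ˡ p _ pu) (IsPrefixInf-++ˡ p _ pv)
           , IsPrefixInf-at p q pu , IsPrefixInf-at p r pv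

NonErasing : Morphism → Set
NonErasing T = ∀ c → T c ≢ []

aperiodic⇒nonErasing : ∀ T → Aperiodic T → NonErasing T
aperiodic⇒nonErasing T aperiodic false T0≡[] =
  aperiodic (subst (λ x → CommonPower x (T true)) (sym T0≡[]) (CommonPower-[]ˡ (T true)))
aperiodic⇒nonErasing T aperiodic true  T1≡[] =
  aperiodic (CommonPower-sym (subst (λ y → CommonPower y (T false)) (sym T1≡[]) (CommonPower-[]ˡ (T false))))

apply-∈* : ∀ T s → apply T s ∈⟨ T false , T true ⟩*
apply-∈* T []          = ε
apply-∈* T (false ∷ s) = x∷ apply-∈* T s
apply-∈* T (true ∷ s)  = y∷ apply-∈* T s

apply-∈*-from : ∀ T c s → apply T s ∈⟨ T c , T (not c) ⟩*
apply-∈*-from T false s = apply-∈* T s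
apply-∈*-from T true  s = ∈*-swap (apply-∈* T s)

length-apply : ∀ {T} → NonErasing T → ∀ s → length s ≤ length (apply T s)
length-apply         ne []      = z≤n
length-apply {T} ne (c ∷ s) =
  subst (suc (length s) ≤_) (sym (length-++ (T c))) (+-mono-≤ (≢[]⇒0<length (ne c)) (length-apply ne s))

apply-pref-split : ∀ T m k u →
  apply T (pref (m + suc k) u) ≡ apply T (pref m u) ++ T (u m) ++ apply T (pref k (λ i → u (suc m + i)))
apply-pref-split T m k u = begin
  apply T (pref (m + suc k) u)                  ≡⟨ cong (apply T) (pref-split m k u) ⟩
  apply T (pref m u ++ u m ∷ S)                 ≡⟨ concatMap-++ T (pref m u) (u m ∷ S) ⟩
  apply T (pref m u) ++ T (u m) ++ apply T S    ∎
  where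
  open ≡-Reasoning
  S = pref k (λ i → u (suc m + i))

image-branch : ∀ {T} → NonErasing T → ∀ {c z} → Branch (T c) (T (not c)) z a →
               ∀ m → u m ≡ c → Image T u X → ∃[ r ] IsPrefixInf ((apply T (pref m u) ++ z) ++ a ∷ r) X
image-branch {u = u} {X = X} {T = T} ne br m refl image =
  let r , xS≡zar = br (apply-∈*-from T (u m) S) long
  in r , subst (λ p → IsPrefixInf p X)
               (trans (apply-pref-split T m k u) (++-prepend (apply T (pref m u)) xS≡zar))
               (image (m + suc k))
  where
  k : ℕ
  k = length (T (not (u m)))
  S : Word
  S = pref k (λ i → u (suc m + i))
  long : k ≤ length (apply T S)
  long = subst (_≤ length (apply T S)) (length-pref k _) (length-apply ne S)

image-cong : ∀ {T} → NonErasing T → u ≡ˡ v → Image T u X → Image T v Y → X ≡ˡ Y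
image-cong {u} {v} {Y = Y} {T = T} ne u≡v imageᵤ imageᵥ i =
  IsPrefixInf-agree (apply T (pref (suc i) u)) (imageᵤ (suc i)) imageᵥ′ i long
  where
  imageᵥ′ : IsPrefixInf (apply T (pref (suc i) u)) Y
  imageᵥ′ = subst (λ p → IsPrefixInf (apply T p) Y) (sym (pref-cong (suc i) (λ j _ → u≡v j)))
                  (imageᵥ (suc i))
  long : i < length (apply T (pref (suc i) u))
  long = subst (_≤ length (apply T (pref (suc i) u))) (length-pref (suc i) u) (length-apply ne (pref (suc i) u))

separation⇒firstDifference : ∀ {T} → NonErasing T → (sep : Separation (T false) (T true)) →
  u <ˡ v → Image T u X → Image T v Y → FirstDifference X Y (Separation.x-letter sep) (Separation.y-letter sep)
separation⇒firstDifference {u = u} {Y = Y} {T = T} ne (separation z _ b _ x-branch y-branch)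
                           (m , u≡v , uₘ≡0 , vₘ≡1) imageᵤ imageᵥ =
  let _ , pX = image-branch ne x-branch m uₘ≡0 imageᵤ
      s , pY = image-branch ne y-branch m vₘ≡1 imageᵥ
  in firstDifference-prefixes (apply T (pref m u) ++ z) pX
       (subst (λ p → IsPrefixInf ((apply T p ++ z) ++ b ∷ s) Y) (sym (pref-cong m u≡v)) pY)

separation⇒monotone : ∀ {T} → NonErasing T → Separation (T false) (T true) →
                      OrderPreserving T ⊎ OrderReversing T
separation⇒monotone ne sep@(separation _ false true _ _ _) = inj₁ preserving
  where
  preserving : OrderPreserving _
  preserving u v X Y (inj₁ u<v) iᵤ iᵥ = inj₁ (separation⇒firstDifference ne sep u<v iᵤ iᵥ)
  preserving u v X Y (inj₂ u≡v) iᵤ iᵥ = inj₂ (image-cong ne u≡v iᵤ iᵥ)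
separation⇒monotone ne sep@(separation _ true false _ _ _) =
  inj₂ λ u v X Y u<v iᵤ iᵥ → FirstDifference-sym (separation⇒firstDifference ne sep u<v iᵤ iᵥ)
separation⇒monotone ne (separation _ false false a≢b _ _) = ⊥-elim (a≢b refl)
separation⇒monotone ne (separation _ true  true  a≢b _ _) = ⊥-elim (a≢b refl)

lemma19 : (T : Morphism) → Aperiodic T → IsPrefix (T true) (T false ++ T true) → OrderPreserving T ⊎ OrderReversing T
lemma19 T aperiodic _ =
  Sum.[ ⊥-elim ∘ aperiodic , separation⇒monotone (aperiodic⇒nonErasing T aperiodic) ]′
    (commonPower⊎separation (T false) (T true))
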